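{- If $T$ is a tree with at least two vertices, then $\mathrm{def}(\widetilde{T})\ge |F(T)|-M(T)-2$.
   Context: All graphs are finite, simple and undirected. Let $T$ be a tree with $V(T)=\{v_1,\dots,v_n\}$, $n\ge2$, and let $F(T)$ be the set of vertices of degree $1$ in $T$. For $i\ne j$, let $P(v_i,v_j)$ be the unique path in $T$ between $v_i$ and $v_j$, with vertex set $VP(v_i,v_j)$ and edge set $EP(v_i,v_j)$, and set $LP(v_i,v_j)=|EP(v_i,v_j)|+|\{vw\in E(T): v\in VP(v_i,v_j),\ w\notin VP(v_i,v_j)\}|$ and $M(T)=\max_{1\le i<j\le n}LP(v_i,v_j)$. The graph $\widetilde{T}$ is obtained from $T$ by adding a new vertex $u$ and joining $u$ to every vertex of $F(T)$. An interval coloring of a graph is a proper edge coloring with positive integers such that the colors at every vertex form an interval of integers. The deficiency $\mathrm{def}(H)$ of a graph $H$ is the minimum number of pendant edges whose attachment to $H$ yields a graph admitting an interval coloring. -}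

module Defs where

open import Data.Nat using (ℕ; zero; suc; _+_; _∸_; _≤_; _≡ᵇ_)
open import Data.Fin using (Fin; _≟_) renaming (zero to fz; suc to fs)
open import Data.Bool using (Bool; true; false; T; _∧_; not; if_then_else_)
open import Data.List using (List; []; _∷_; length; head; last)
open import Data.List.Relation.Unary.Linked using (Linked)
open import Data.List.Relation.Unary.Unique.Propositional using (Unique)
open import Data.Maybe using (Maybe; just; nothing)
open import Data.Sum using (_⊎_; inj₁; inj₂)
open import Data.Product using (Σ; ∃; _×_)
open import Data.Empty using (⊥)
open import Relation.Nullary using (¬_; does)
open import Relation.Binary.PropositionalEquality using (_≡_; _≢_)

record Graph (n : ℕ) : Set where
  field
    adj    : Fin n → Fin n → Bool
    sym    : ∀ i j → adj i j ≡ adj j i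
    irrefl : ∀ i → adj i i ≡ false
open Graph public

sumFin : ∀ {n} → (Fin n → ℕ) → ℕ
sumFin {zero}  f = 0
sumFin {suc n} f = f fz + sumFin (λ i → f (fs i))

count : ∀ {n} → (Fin n → Bool) → ℕ
count f = sumFin (λ i → if f i then 1 else 0)

deg : ∀ {n} → Graph n → Fin n → ℕ
deg G i = count (adj G i)

isLeaf : ∀ {n} → Graph n → Fin n → Bool
isLeaf G i = deg G i ≡ᵇ 1

numLeaves : ∀ {n} → Graph n → ℕ
numLeaves G = count (isLeaf G)

Adj : ∀ {n} → Graph n → Fin n → Fin n → Set
Adj G i j = T (adj G i j)

PathBetween : ∀ {n} → Graph n → Fin n → Fin n → List (Fin n) → Set
PathBetween G i j p =
  Linked (Adj G) p × Unique p × head p ≡ just i × last p ≡ just j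

Connected : ∀ {n} → Graph n → Set
Connected G = ∀ i j → ∃ λ p → PathBetween G i j p

IsCycle : ∀ {n} → Graph n → List (Fin n) → Set
IsCycle {n} G c = 3 ≤ length c × Linked (Adj G) c × Unique c ×
  Σ (Fin n) λ a → Σ (Fin n) λ b → head c ≡ just a × last c ≡ just b × Adj G b a

Acyclic : ∀ {n} → Graph n → Set
Acyclic G = ∀ c → ¬ IsCycle G c

IsTree : ∀ {n} → Graph n → Set
IsTree G = Connected G × Acyclic G

_∈ᵇ_ : ∀ {n} → Fin n → List (Fin n) → Bool
x ∈ᵇ []       = false
x ∈ᵇ (y ∷ ys) = if does (x ≟ y) then true else (x ∈ᵇ ys)

-- LP of the path with vertex list p:
-- |EP| + |{vw ∈ E : v ∈ VP, w ∉ VP}|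
LP : ∀ {n} → Graph n → List (Fin n) → ℕ
LP G p = (length p ∸ 1)
       + sumFin (λ v → count (λ w → (v ∈ᵇ p) ∧ not (w ∈ᵇ p) ∧ adj G v w))

IsM : ∀ {n} → Graph n → ℕ → Set
IsM {n} G m =
  (Σ (Fin n) λ i → Σ (Fin n) λ j → Σ (List (Fin n)) λ p →
      i ≢ j × PathBetween G i j p × LP G p ≡ m)
  × (∀ i j p → i ≢ j → PathBetween G i j p → LP G p ≤ m)

-- T̃: new vertex u = nothing, joined to every leaf of T
tildeAdj : ∀ {n} → Graph n → Maybe (Fin n) → Maybe (Fin n) → Set
tildeAdj G (just i) (just j) = Adj G i j
tildeAdj G (just i) nothing  = T (isLeaf G i)
tildeAdj G nothing  (just j) = T (isLeaf G j)
tildeAdj G nothing  nothing  = ⊥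

-- attach p pendant edges: new vertex k is joined only to f k
attach : ∀ {V : Set} → (V → V → Set) → ∀ {p} → (Fin p → V) → (V ⊎ Fin p) → (V ⊎ Fin p) → Set
attach E f (inj₁ x) (inj₁ y) = E x y
attach E f (inj₁ x) (inj₂ k) = f k ≡ x
attach E f (inj₂ k) (inj₁ x) = f k ≡ x
attach E f (inj₂ k) (inj₂ l) = ⊥

ColorAt : ∀ {V : Set} → (V → V → Set) → (V → V → ℕ) → V → ℕ → Set
ColorAt {V} E c v k = Σ V λ w → E v w × c v w ≡ k

record IntervalColoring {V : Set} (E : V → V → Set) : Set where
  field
    c        : V → V → ℕ
    symm     : ∀ x y → E x y → c x y ≡ c y x
    positive : ∀ x y → E x y → 1 ≤ c x y
    proper   : ∀ x y z → E x y → E x z → c x y ≡ c x z → y ≡ z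
    interval : ∀ v a b k → ColorAt E c v a → ColorAt E c v b →
               a ≤ k → k ≤ b → ColorAt E c v k

IsDeficiency : ∀ {V : Set} → (V → V → Set) → ℕ → Set
IsDeficiency {V} E d =
  (Σ (Fin d → V) λ f → IntervalColoring (attach E f))
  × (∀ p (f : Fin p → V) → IntervalColoring (attach E f) → d ≤ p)

{-# OPTIONS --safe #-}
-- Fix an interval colouring of T̃ with d pendant edges attached. The edges
-- joining the new vertex u to the leaves get pairwise distinct colours. Let a be
-- the leaf whose edge to u has the least colour, and follow the tree path P from
-- a to another leaf b. The colours at a vertex x form an interval of at most
-- D(x) values, D(x) the degree of x in the coloured graph, so from the edge
-- entering x to the edge leaving it the colour grows by at most D(x) - 1, which
-- on P is at most 1 + (edges of T leaving P at x) + (pendant edges at x).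
-- Summing along P, the colour of ub exceeds that of ua by at most
-- |VP| + (edges leaving P) + d = LP(P) + 1 + d <= M(T) + d + 1, so the |F(T)|
-- leaf colours lie in an interval of M(T) + d + 2 values.
module Submission where

open import Defs hiding (sym)
open import Data.Bool using (Bool; true; false; T; _∧_; not; if_then_else_)
open import Data.Bool.Properties using (T-∧)
open import Data.Empty using (⊥-elim)
open import Data.Fin using (Fin; toℕ; fromℕ<; _≟_) renaming (zero to fz; suc to fs)
open import Data.Fin.Properties using (toℕ-injective; toℕ-fromℕ<; toℕ<n; any?) renaming (suc-injective to fs-injective)
open import Data.List using (List; []; _∷_; _++_; [_]; length; head; last; map; filter; allFin)
open import Data.Nat.ListAction using (sum)
open import Data.List.Properties using (++-assoc)
open import Data.List.Extrema.Nat using (argmin; argmin-all; f[argmin]≤f[xs])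
open import Data.List.Membership.Propositional using (_∈_)
open import Data.List.Membership.Propositional.Properties
  using (∈-∃++; ∈-++⁻; ∈-++⁺ʳ; ∈-filter⁺; ∈-allFin)
open import Data.List.Relation.Unary.All using (All; []; _∷_; lookup; tabulate)
open import Data.List.Relation.Unary.All.Properties using (all-filter; ++⁻ˡ)
open import Data.List.Relation.Unary.Any using (here; there)
open import Data.List.Relation.Unary.Linked as Linked using (Linked; []; [-]; _∷_)
open import Data.List.Relation.Unary.Unique.Propositional using (Unique)
open import Data.List.Relation.Unary.AllPairs using ([]; _∷_)
open import Data.Maybe using (Maybe; just; nothing)
open import Data.Maybe.Properties using (just-injective) renaming (≡-dec to ≡-decᴹ)
open import Data.Nat using (ℕ; zero; suc; _+_; _∸_; _≤_; _<_; _≡ᵇ_; z≤n; s≤s; z<s; _≤?_)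
open import Data.Nat.Properties hiding (_≟_)
open import Algebra.Properties.CommutativeSemigroup +-commutativeSemigroup
  using (interchange; xy∙z≈xz∙y; x∙yz≈y∙xz)
open import Data.Product using (∃; _×_; _,_; proj₁; proj₂; uncurry)
open import Data.Sum using (_⊎_; inj₁; inj₂)
open import Data.Unit using (tt)
open import Function using (_∘_; Equivalence)
open import Relation.Nullary using (¬_; Dec; does; yes; no; contradiction)
open import Relation.Nullary.Decidable using (T?)
open import Relation.Binary.PropositionalEquality hiding ([_])

indicator : Bool → ℕ
indicator b = if b then 1 else 0

does-sound : ∀ {A : Set} (a? : Dec A) → T (does a?) → A
does-sound (yes a) _ = a

does-complete : ∀ {A : Set} (a? : Dec A) → A → T (does a?)
does-complete (yes _) _  = tt
does-complete (no ¬a) a = ¬a a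

-- Finite sums and counting

sumFin-cong : ∀ {n} {f g : Fin n → ℕ} → (∀ i → f i ≡ g i) → sumFin f ≡ sumFin g
sumFin-cong {zero}  f≡g = refl
sumFin-cong {suc n} f≡g = cong₂ _+_ (f≡g fz) (sumFin-cong (f≡g ∘ fs))

sumFin-mono : ∀ {n} {f g : Fin n → ℕ} → (∀ i → f i ≤ g i) → sumFin f ≤ sumFin g
sumFin-mono {zero}  f≤g = z≤n
sumFin-mono {suc n} f≤g = +-mono-≤ (f≤g fz) (sumFin-mono (f≤g ∘ fs))

sumFin-+ : ∀ {n} (f g : Fin n → ℕ) → sumFin (λ i → f i + g i) ≡ sumFin f + sumFin g
sumFin-+ {zero}  f g = refl
sumFin-+ {suc n} f g = trans (cong (f fz + g fz +_) (sumFin-+ (f ∘ fs) (g ∘ fs)))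
                             (interchange (f fz) (g fz) (sumFin (f ∘ fs)) (sumFin (g ∘ fs)))

sumFin-zero : ∀ {n} → sumFin {n} (λ _ → 0) ≡ 0
sumFin-zero {zero}  = refl
sumFin-zero {suc n} = sumFin-zero {n}

sumFin-one : ∀ {n} → sumFin {n} (λ _ → 1) ≡ n
sumFin-one {zero}  = refl
sumFin-one {suc n} = cong suc (sumFin-one {n})

term≤sumFin : ∀ {n} (f : Fin n → ℕ) i → f i ≤ sumFin f
term≤sumFin f fz     = m≤m+n _ _
term≤sumFin f (fs i) = ≤-trans (term≤sumFin (f ∘ fs) i) (m≤n+m _ _)

sumFin-comm : ∀ {m n} (h : Fin m → Fin n → ℕ) →
  sumFin (λ i → sumFin (h i)) ≡ sumFin (λ j → sumFin (λ i → h i j))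
sumFin-comm {zero} {n} h = sym (sumFin-zero {n})
sumFin-comm {suc m} h = trans (cong (sumFin (h fz) +_) (sumFin-comm (h ∘ fs)))
                              (sym (sumFin-+ (h fz) (λ j → sumFin (λ i → h (fs i) j))))

AtMostOne : ∀ {n} → (Fin n → Bool) → Set
AtMostOne Q = ∀ i j → T (Q i) → T (Q j) → i ≡ j

indicator-pos : ∀ {b} → T b → 1 ≤ indicator b
indicator-pos {true} _ = ≤-refl

count-pos : ∀ {n} (Q : Fin n → Bool) i → T (Q i) → 1 ≤ count Q
count-pos Q i Qi = ≤-trans (indicator-pos Qi) (term≤sumFin (indicator ∘ Q) i)

count-zero : ∀ {n} (Q : Fin n → Bool) → (∀ i → ¬ T (Q i)) → count Q ≡ 0
count-zero {zero}  Q none = refl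
count-zero {suc n} Q none with Q fz in eq
... | true  = contradiction (subst T (sym eq) tt) (none fz)
... | false = count-zero (Q ∘ fs) (none ∘ fs)

count-mono : ∀ {n} (P Q : Fin n → Bool) → (∀ i → T (P i) → T (Q i)) → count P ≤ count Q
count-mono P Q P⇒Q = sumFin-mono pointwise
  where
  pointwise : ∀ i → indicator (P i) ≤ indicator (Q i)
  pointwise i with P i | Q i | P⇒Q i
  ... | false | _     | _   = z≤n
  ... | true  | true  | _   = ≤-refl
  ... | true  | false | P⇒Q = ⊥-elim (P⇒Q tt)

count-≤-+ : ∀ {n} (Q A B : Fin n → Bool) → (∀ i → T (Q i) → T (A i) ⊎ T (B i)) →
  count Q ≤ count A + count B
count-≤-+ Q A B cover = ≤-trans (sumFin-mono pointwise) (≤-reflexive (sumFin-+ (indicator ∘ A) (indicator ∘ B)))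
  where
  pointwise : ∀ i → indicator (Q i) ≤ indicator (A i) + indicator (B i)
  pointwise i with Q i | A i | B i | cover i
  ... | false | _     | _     | _     = z≤n
  ... | true  | true  | _     | _     = s≤s z≤n
  ... | true  | false | true  | _     = s≤s z≤n
  ... | true  | false | false | cover with cover tt
  ...   | inj₁ ()
  ...   | inj₂ ()

count≤1 : ∀ {n} (Q : Fin n → Bool) → AtMostOne Q → count Q ≤ 1
count≤1 {zero}  Q once = z≤n
count≤1 {suc n} Q once with Q fz in eq
... | true  = ≤-reflexive (cong suc (count-zero (Q ∘ fs)
                (λ i Qi → contradiction (once fz (fs i) (subst T (sym eq) tt) Qi) λ ())))
... | false = count≤1 (Q ∘ fs) (λ i j Qi Qj → fs-injective (once (fs i) (fs j) Qi Qj))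

count-∧≤indicator : ∀ {n} b (P : Fin n → Bool) → AtMostOne P → count (λ i → b ∧ P i) ≤ indicator b
count-∧≤indicator true  P once = count≤1 P once
count-∧≤indicator {n} false P once = ≤-reflexive (sumFin-zero {n})

indicator≤count-∧ : ∀ {n} b (P : Fin n → Bool) → (T b → ∃ λ i → T (P i)) →
  indicator b ≤ count (λ i → b ∧ P i)
indicator≤count-∧ true  P witness = count-pos P (proj₁ (witness tt)) (proj₂ (witness tt))
indicator≤count-∧ false P witness = z≤n

minimum-on : ∀ {n} (Q : Fin n → Bool) (g : Fin n → ℕ) {j} → T (Q j) →
  ∃ λ a → T (Q a) × (∀ i → T (Q i) → g a ≤ g i)
minimum-on {n} Q g {j} Qj =
  a , argmin-all g Qj (all-filter Q? (allFin n)) ,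
  λ i Qi → lookup (f[argmin]≤f[xs] j candidates) (∈-filter⁺ Q? (∈-allFin i) Qi)
  where
  Q? = λ i → T? (Q i)
  candidates = filter Q? (allFin n)
  a = argmin g j candidates

-- Sums over an interval of integers and pigeonhole bounds

rangeSum : ℕ → ℕ → (ℕ → ℕ) → ℕ
rangeSum a l h = sumFin {l} (λ k → h (a + toℕ k))

rangeSum-+ : ∀ a l (g h : ℕ → ℕ) → rangeSum a l (λ k → g k + h k) ≡ rangeSum a l g + rangeSum a l h
rangeSum-+ a l g h = sumFin-+ {l} (λ i → g (a + toℕ i)) (λ i → h (a + toℕ i))

fibre : ∀ {n} → (Fin n → Bool) → (Fin n → ℕ) → ℕ → ℕ
fibre Q g k = count (λ j → Q j ∧ (g j ≡ᵇ k))

offset-atMostOne : ∀ a {l} z → AtMostOne {l} (λ k → z ≡ᵇ a + toℕ k)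
offset-atMostOne a z i j hi hj =
  toℕ-injective (+-cancelˡ-≡ a _ _ (trans (sym (≡ᵇ⇒≡ z _ hi)) (≡ᵇ⇒≡ z _ hj)))

offset-exists : ∀ {a l z} → a ≤ z → z < a + l → ∃ λ (k : Fin l) → T (z ≡ᵇ a + toℕ k)
offset-exists {a} {l} {z} a≤z z<a+l = fromℕ< z∸a<l , ≡⇒≡ᵇ z _ z≡a+k
  where
  a+[z∸a]≡z : a + (z ∸ a) ≡ z
  a+[z∸a]≡z = m+[n∸m]≡n a≤z
  z∸a<l : z ∸ a < l
  z∸a<l = +-cancelˡ-< a _ _ (subst (_< a + l) (sym a+[z∸a]≡z) z<a+l)
  z≡a+k : z ≡ a + toℕ (fromℕ< z∸a<l)
  z≡a+k = trans (sym a+[z∸a]≡z) (cong (a +_) (sym (toℕ-fromℕ< z∸a<l)))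

rangeSum-fibre≤count : ∀ {n} a l (Q : Fin n → Bool) (g : Fin n → ℕ) →
  rangeSum a l (fibre Q g) ≤ count Q
rangeSum-fibre≤count a l Q g = begin
  rangeSum a l (fibre Q g)
    ≡⟨ sumFin-comm {l} (λ k j → indicator (Q j ∧ (g j ≡ᵇ a + toℕ k))) ⟩
  sumFin (λ j → count {l} (λ k → Q j ∧ (g j ≡ᵇ a + toℕ k)))
    ≤⟨ sumFin-mono (λ j → count-∧≤indicator {l} (Q j) _ (offset-atMostOne a (g j))) ⟩
  count Q ∎
  where open ≤-Reasoning

count≤rangeSum-fibre : ∀ {n} a l (Q : Fin n → Bool) (g : Fin n → ℕ) →
  (∀ j → T (Q j) → a ≤ g j × g j < a + l) → count Q ≤ rangeSum a l (fibre Q g)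
count≤rangeSum-fibre a l Q g range = begin
  count Q
    ≤⟨ sumFin-mono (λ j → indicator≤count-∧ {l} (Q j) _ (uncurry offset-exists ∘ range j)) ⟩
  sumFin (λ j → count {l} (λ k → Q j ∧ (g j ≡ᵇ a + toℕ k)))
    ≡⟨ sumFin-comm {m = _} {l} (λ j k → indicator (Q j ∧ (g j ≡ᵇ a + toℕ k))) ⟩
  rangeSum a l (fibre Q g) ∎
  where open ≤-Reasoning

injective-count≤length : ∀ {n} a l (Q : Fin n → Bool) (g : Fin n → ℕ) →
  (∀ j → T (Q j) → a ≤ g j × g j < a + l) →
  (∀ i j → T (Q i) → T (Q j) → g i ≡ g j → i ≡ j) →
  count Q ≤ l
injective-count≤length a l Q g range injective = begin
  count Q                  ≤⟨ count≤rangeSum-fibre a l Q g range ⟩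
  rangeSum a l (fibre Q g) ≤⟨ sumFin-mono {l} (λ k → count≤1 _ (fibre-atMostOne (a + toℕ k))) ⟩
  sumFin {l} (λ _ → 1)     ≡⟨ sumFin-one ⟩
  l ∎
  where
  open ≤-Reasoning
  fibre-atMostOne : ∀ k → AtMostOne (λ j → Q j ∧ (g j ≡ᵇ k))
  fibre-atMostOne k i j Pi Pj = injective i j (proj₁ Pi′) (proj₁ Pj′)
      (trans (≡ᵇ⇒≡ _ _ (proj₂ Pi′)) (sym (≡ᵇ⇒≡ _ _ (proj₂ Pj′))))
    where
    Pi′ = Equivalence.to T-∧ Pi
    Pj′ = Equivalence.to T-∧ Pj

-- Paths in acyclic graphs

Adj-sym : ∀ {n} (G : Graph n) {x y} → Adj G x y → Adj G y x
Adj-sym G {x} {y} = subst T (Graph.sym G x y)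

Adj-irrefl : ∀ {n} (G : Graph n) {x} → ¬ Adj G x x
Adj-irrefl G {x} = subst T (irrefl G x)

∈ᵇ⇒∈ : ∀ {n} {w : Fin n} xs → T (w ∈ᵇ xs) → w ∈ xs
∈ᵇ⇒∈ {w = w} (y ∷ ys) w∈ with w ≟ y
... | yes w≡y = here w≡y
... | no  _   = there (∈ᵇ⇒∈ ys w∈)

last-++-[_] : ∀ {A : Set} (xs : List A) x → last (xs ++ [ x ]) ≡ just x
last-++-[_] []           x = refl
last-++-[_] (_ ∷ [])     x = refl
last-++-[_] (_ ∷ y ∷ xs) x = last-++-[ y ∷ xs ] x

LPBoundedBy : ∀ {n} → Graph n → ℕ → Set
LPBoundedBy {n} G m = ∀ (i j : Fin n) p → i ≢ j → PathBetween G i j p → LP G p ≤ m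

IsPath : ∀ {n} → Graph n → List (Fin n) → Set
IsPath G p = Linked (Adj G) p × Unique p

IsPath-++⁻ˡ : ∀ {n} (G : Graph n) xs {ys} → IsPath G (xs ++ ys) → IsPath G xs
IsPath-++⁻ˡ G xs (linked , unique) = linked-prefix xs linked , unique-prefix xs unique
  where
  linked-prefix : ∀ {A : Set} {R : A → A → Set} xs {ys} → Linked R (xs ++ ys) → Linked R xs
  linked-prefix []           _          = []
  linked-prefix (x ∷ [])     _          = [-]
  linked-prefix (x ∷ y ∷ xs) (r ∷ rest) = r ∷ linked-prefix (y ∷ xs) rest
  unique-prefix : ∀ {A : Set} xs {ys : List A} → Unique (xs ++ ys) → Unique xs
  unique-prefix []       _          = []
  unique-prefix (x ∷ xs) (x∉ ∷ rest) = ++⁻ˡ xs x∉ ∷ unique-prefix xs rest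

IsPath-++⁻ʳ : ∀ {n} (G : Graph n) xs {ys} → IsPath G (xs ++ ys) → IsPath G ys
IsPath-++⁻ʳ G []       path                  = path
IsPath-++⁻ʳ G (x ∷ xs) (linked , _ ∷ unique) = IsPath-++⁻ʳ G xs (Linked.tail linked , unique)

no-chord : ∀ {n} (G : Graph n) → Acyclic G → ∀ {x y r w} →
  IsPath G (x ∷ y ∷ r) → w ∈ r → ¬ Adj G x w
no-chord G acyclic {x} {y} {r} {w} path w∈r x~w with ∈-∃++ w∈r
... | r₁ , r₂ , refl =
  acyclic cycle (s≤s (s≤s (nonempty r₁)) , proj₁ cycle-path , proj₂ cycle-path ,
                 x , w , refl , last-++-[ x ∷ y ∷ r₁ ] w , Adj-sym G x~w)
  where
  cycle = x ∷ y ∷ r₁ ++ [ w ]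
  cycle-path : IsPath G cycle
  cycle-path = IsPath-++⁻ˡ G cycle (subst (IsPath G) (cong (λ t → x ∷ y ∷ t) (sym (++-assoc r₁ [ w ] r₂))) path)
  nonempty : ∀ zs → 1 ≤ length (zs ++ [ w ])
  nonempty []      = s≤s z≤n
  nonempty (_ ∷ _) = s≤s z≤n

path-neighbour : ∀ {n} (G : Graph n) → Acyclic G → ∀ l {x r w} →
  IsPath G (l ++ x ∷ r) → w ∈ l ++ x ∷ r → Adj G x w → last l ≡ just w ⊎ head r ≡ just w
path-neighbour G acyclic l {x} {r} {w} path w∈p x~w with ∈-++⁻ l w∈p
... | inj₂ (here refl)  = contradiction x~w (Adj-irrefl G)
... | inj₂ (there w∈r) = successor r w∈r (IsPath-++⁻ʳ G l path)
  where
  successor : ∀ r → w ∈ r → IsPath G (x ∷ r) → last l ≡ just w ⊎ head r ≡ just w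
  successor (_ ∷ _)  (here refl)  _     = inj₂ refl
  successor (_ ∷ r′) (there w∈r′) path′ = contradiction x~w (no-chord G acyclic path′ w∈r′)
... | inj₁ w∈l with ∈-∃++ w∈l
...   | l₁ , []     , refl = inj₁ (last-++-[ l₁ ] w)
...   | l₁ , y ∷ l₂ , refl =
  contradiction (Adj-sym G x~w) (no-chord G acyclic (IsPath-++⁻ʳ G l₁ path′) (∈-++⁺ʳ l₂ (here refl)))
  where
  path′ : IsPath G (l₁ ++ w ∷ y ∷ l₂ ++ x ∷ r)
  path′ = subst (IsPath G) (++-assoc l₁ (w ∷ y ∷ l₂) (x ∷ r)) path

_≟ᴹ_ : ∀ {n} (a b : Maybe (Fin n)) → Dec (a ≡ b)
_≟ᴹ_ = ≡-decᴹ _≟_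

count-≡just≤1 : ∀ {n} (m : Maybe (Fin n)) → count (λ w → does (m ≟ᴹ just w)) ≤ 1
count-≡just≤1 m = count≤1 _ λ i j m≡i m≡j →
  just-injective (trans (sym (does-sound (m ≟ᴹ _) m≡i)) (does-sound (m ≟ᴹ _) m≡j))

inPath outPath : ∀ {n} → Graph n → List (Fin n) → Fin n → ℕ
inPath  G p x = count (λ w → (w ∈ᵇ p) ∧ adj G x w)
outPath G p x = count (λ w → not (w ∈ᵇ p) ∧ adj G x w)

deg≡inPath+outPath : ∀ {n} (G : Graph n) p x → deg G x ≡ inPath G p x + outPath G p x
deg≡inPath+outPath {n} G p x = trans (sumFin-cong pointwise) (sumFin-+ {n} _ _)
  where
  pointwise : ∀ w → indicator (adj G x w)
                  ≡ indicator ((w ∈ᵇ p) ∧ adj G x w) + indicator (not (w ∈ᵇ p) ∧ adj G x w)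
  pointwise w with w ∈ᵇ p
  ... | true  = sym (+-identityʳ _)
  ... | false = refl

inPath≤2 : ∀ {n} (G : Graph n) → Acyclic G → ∀ {p x} → IsPath G p → x ∈ p → inPath G p x ≤ 2
inPath≤2 G acyclic path x∈p with ∈-∃++ x∈p
... | l , r , refl = ≤-trans (count-≤-+ _ _ _ neighbour)
                             (+-mono-≤ (count-≡just≤1 (last l)) (count-≡just≤1 (head r)))
  where
  neighbour : ∀ w → T ((w ∈ᵇ (l ++ _ ∷ r)) ∧ adj G _ w) →
              T (does (last l ≟ᴹ just w)) ⊎ T (does (head r ≟ᴹ just w))
  neighbour w t with Equivalence.to T-∧ t
  ... | w∈ , x~w with path-neighbour G acyclic l path (∈ᵇ⇒∈ _ w∈) x~w
  ...   | inj₁ e = inj₁ (does-complete (last l ≟ᴹ _) e)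
  ...   | inj₂ e = inj₂ (does-complete (head r ≟ᴹ _) e)

inPath+leaf≤2 : ∀ {n} (G : Graph n) → Acyclic G → ∀ {p x} → IsPath G p → x ∈ p →
  inPath G p x + indicator (isLeaf G x) ≤ 2
inPath+leaf≤2 G acyclic {p} {x} path x∈p with isLeaf G x in leaf
... | false = ≤-trans (≤-reflexive (+-identityʳ _)) (inPath≤2 G acyclic path x∈p)
... | true  = +-monoˡ-≤ 1 (begin
  inPath G p x ≤⟨ count-mono _ (adj G x) (λ w → proj₂ ∘ Equivalence.to T-∧) ⟩
  deg G x      ≡⟨ ≡ᵇ⇒≡ (deg G x) 1 (subst T (sym leaf) tt) ⟩
  1            ∎)
  where open ≤-Reasoning

sum-map-+ : ∀ {A : Set} (f g : A → ℕ) xs →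
  sum (map (λ x → f x + g x) xs) ≡ sum (map f xs) + sum (map g xs)
sum-map-+ f g []       = refl
sum-map-+ f g (x ∷ xs) = trans (cong (f x + g x +_) (sum-map-+ f g xs))
                               (interchange (f x) (g x) (sum (map f xs)) (sum (map g xs)))

sum-map-one : ∀ {A : Set} (xs : List A) → sum (map (λ _ → 1) xs) ≡ length xs
sum-map-one []       = refl
sum-map-one (_ ∷ xs) = cong suc (sum-map-one xs)

sum-map≤sumFin : ∀ {n} (h : Fin n → ℕ) {xs} → Unique xs →
  sum (map h xs) ≤ sumFin (λ v → if v ∈ᵇ xs then h v else 0)
sum-map≤sumFin h {[]}     _            = z≤n
sum-map≤sumFin h {x ∷ xs} (x∉xs ∷ unique) = begin
  h x + sum (map h xs)      ≤⟨ +-mono-≤ (≤-trans at-x (term≤sumFin at x)) (sum-map≤sumFin h unique) ⟩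
  sumFin at + sumFin rest   ≡⟨ sym (sumFin-+ at rest) ⟩
  sumFin (λ v → at v + rest v) ≤⟨ sumFin-mono pointwise ⟩
  sumFin (λ v → if v ∈ᵇ (x ∷ xs) then h v else 0) ∎
  where
  open ≤-Reasoning
  at rest : Fin _ → ℕ
  at   v = if does (v ≟ x) then h v else 0
  rest v = if v ∈ᵇ xs then h v else 0
  at-x : h x ≤ at x
  at-x with x ≟ x
  ... | yes _   = ≤-refl
  ... | no  x≢x = contradiction refl x≢x
  pointwise : ∀ v → at v + rest v ≤ (if v ∈ᵇ (x ∷ xs) then h v else 0)
  pointwise v with v ≟ x
  ... | no  _    = ≤-refl
  ... | yes refl with v ∈ᵇ xs in v∈xs
  ...   | false = ≤-reflexive (+-identityʳ _)
  ...   | true  = contradiction refl (lookup x∉xs (∈ᵇ⇒∈ xs (subst T (sym v∈xs) tt)))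

-- Interval colourings of T̃ with pendant edges

pendantAt : ∀ {n d} → (Fin d → Maybe (Fin n)) → Fin n → Fin d → Bool
pendantAt f x q = does (f q ≟ᴹ just x)

pendants : ∀ {n d} → (Fin d → Maybe (Fin n)) → Fin n → ℕ
pendants f x = count (pendantAt f x)

sumFin-pendants≤ : ∀ {n d} (f : Fin d → Maybe (Fin n)) → sumFin (pendants f) ≤ d
sumFin-pendants≤ {n} {d} f = begin
  sumFin (pendants f)   ≡⟨ sumFin-comm (λ x q → indicator (does (f q ≟ᴹ just x))) ⟩
  sumFin (λ q → count (λ x → does (f q ≟ᴹ just x))) ≤⟨ sumFin-mono (λ q → count-≡just≤1 (f q)) ⟩
  sumFin {d} (λ _ → 1) ≡⟨ sumFin-one ⟩
  d ∎
  where open ≤-Reasoning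

module Colouring {n d} (G : Graph n) (f : Fin d → Maybe (Fin n))
                 (C : IntervalColoring (attach (tildeAdj G) f)) where

  open IntervalColoring C

  E : (Maybe (Fin n) ⊎ Fin d) → (Maybe (Fin n) ⊎ Fin d) → Set
  E = attach (tildeAdj G) f

  vertex : Fin n → Maybe (Fin n) ⊎ Fin d
  vertex x = inj₁ (just x)

  apex : Maybe (Fin n) ⊎ Fin d
  apex = inj₁ nothing

  valency : Fin n → ℕ
  valency x = deg G x + indicator (isLeaf G x) + pendants f x

  treeFibre apexFibre pendantFibre multiplicity : Fin n → ℕ → ℕ
  treeFibre    x   = fibre (adj G x) (λ j → c (vertex x) (vertex j))
  apexFibre    x k = indicator (isLeaf G x ∧ (c (vertex x) apex ≡ᵇ k))
  pendantFibre x   = fibre (pendantAt f x) (λ q → c (vertex x) (inj₂ q))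
  multiplicity x k = treeFibre x k + apexFibre x k + pendantFibre x k

  multiplicity-pos : ∀ x k → ColorAt E c (vertex x) k → 1 ≤ multiplicity x k
  multiplicity-pos x k (inj₁ (just j) , x~j , refl) =
    ≤-trans (count-pos _ j (Equivalence.from T-∧ (x~j , ≡⇒≡ᵇ k k refl)))
            (≤-trans (m≤m+n (treeFibre x k) (apexFibre x k)) (m≤m+n _ (pendantFibre x k)))
  multiplicity-pos x k (inj₁ nothing , leaf , refl) =
    ≤-trans (indicator-pos (Equivalence.from T-∧ (leaf , ≡⇒≡ᵇ k k refl)))
            (≤-trans (m≤n+m (apexFibre x k) (treeFibre x k)) (m≤m+n _ (pendantFibre x k)))
  multiplicity-pos x k (inj₂ q , q~x , refl) =
    ≤-trans (count-pos _ q (Equivalence.from T-∧ (does-complete (f q ≟ᴹ just x) q~x , ≡⇒≡ᵇ k k refl)))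
            (m≤n+m (pendantFibre x k) (treeFibre x k + apexFibre x k))

  rangeSum-multiplicity≤valency : ∀ x a l → rangeSum a l (multiplicity x) ≤ valency x
  rangeSum-multiplicity≤valency x a l = begin
    rangeSum a l (multiplicity x)
      ≡⟨ rangeSum-+ a l (λ k → treeFibre x k + apexFibre x k) (pendantFibre x) ⟩
    rangeSum a l (λ k → treeFibre x k + apexFibre x k) + rangeSum a l (pendantFibre x)
      ≡⟨ cong (_+ rangeSum a l (pendantFibre x)) (rangeSum-+ a l (treeFibre x) (apexFibre x)) ⟩
    rangeSum a l (treeFibre x) + rangeSum a l (apexFibre x) + rangeSum a l (pendantFibre x)
      ≤⟨ +-mono-≤ (+-mono-≤ (rangeSum-fibre≤count a l (adj G x) (λ j → c (vertex x) (vertex j)))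
                            (count-∧≤indicator {l} (isLeaf G x) _ (offset-atMostOne a (c (vertex x) apex))))
                  (rangeSum-fibre≤count a l (pendantAt f x) (λ q → c (vertex x) (inj₂ q))) ⟩
    valency x ∎
    where open ≤-Reasoning

  colour-spread : ∀ x {y₁ y₂} → E (vertex x) y₁ → E (vertex x) y₂ →
    c (vertex x) y₂ < c (vertex x) y₁ + valency x
  colour-spread x {y₁} {y₂} e₁ e₂ with c (vertex x) y₁ + valency x ≤? c (vertex x) y₂
  ... | no  ≰ = ≰⇒> ≰
  ... | yes α+v≤β = contradiction (begin
    suc (valency x)                               ≡⟨ sym sumFin-one ⟩
    sumFin {suc (valency x)} (λ _ → 1)            ≤⟨ sumFin-mono {suc (valency x)} present ⟩
    rangeSum α (suc (valency x)) (multiplicity x) ≤⟨ rangeSum-multiplicity≤valency x α (suc (valency x)) ⟩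
    valency x                                     ∎) 1+n≰n
    where
    open ≤-Reasoning
    α = c (vertex x) y₁
    present : ∀ (k : Fin (suc (valency x))) → 1 ≤ multiplicity x (α + toℕ k)
    present k = multiplicity-pos x _ (interval (vertex x) α _ (α + toℕ k) (y₁ , e₁ , refl) (y₂ , e₂ , refl)
      (m≤m+n α _) (≤-trans (+-monoʳ-≤ α (≤-pred (toℕ<n k))) α+v≤β))

  SpreadAtMost : Fin n → ℕ → Set
  SpreadAtMost x s = ∀ {y₁ y₂} → E (vertex x) y₁ → E (vertex x) y₂ → c (vertex x) y₂ ≤ c (vertex x) y₁ + s

  colour-drift : ∀ (s : Fin n → ℕ) {x q b y z} → Linked (Adj G) (x ∷ q) →
    All (λ v → SpreadAtMost v (s v)) (x ∷ q) → last (x ∷ q) ≡ just b →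
    E (vertex x) y → E (vertex b) z → c (vertex b) z ≤ c (vertex x) y + sum (map s (x ∷ q))
  colour-drift s {x} {q = []} {y = y} {z} _ (spread ∷ []) refl x~y b~z =
    ≤-trans (spread {y} {z} x~y b~z) (≤-reflexive (cong (c (vertex x) y +_) (sym (+-identityʳ (s x)))))
  colour-drift s {x} {x′ ∷ q} {b} {y} {z} (x~x′ ∷ linked) (spread ∷ spreads) last≡b x~y b~z = begin
    c (vertex b) z                                    ≤⟨ colour-drift s linked spreads last≡b (Adj-sym G x~x′) b~z ⟩
    c (vertex x′) (vertex x) + sum (map s (x′ ∷ q))   ≡⟨ cong (_+ _) (symm _ _ (Adj-sym G x~x′)) ⟩
    c (vertex x) (vertex x′) + sum (map s (x′ ∷ q))   ≤⟨ +-monoˡ-≤ _ (spread x~y x~x′) ⟩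
    c (vertex x) y + s x + sum (map s (x′ ∷ q))       ≡⟨ +-assoc (c (vertex x) y) (s x) _ ⟩
    c (vertex x) y + sum (map s (x ∷ x′ ∷ q))         ∎
    where open ≤-Reasoning

-- Leaf colours in a tree

module LeafColours {n d} (G : Graph n) (acyclic : Acyclic G) (f : Fin d → Maybe (Fin n))
                   (C : IntervalColoring (attach (tildeAdj G) f)) where

  open IntervalColoring C using (c; symm; proper)
  open Colouring G f C

  apexColour : Fin n → ℕ
  apexColour x = c apex (vertex x)

  weight : List (Fin n) → Fin n → ℕ
  weight p x = suc (outPath G p x + pendants f x)

  valency-on-path : ∀ {p x} → IsPath G p → x ∈ p → valency x ≤ 2 + (outPath G p x + pendants f x)
  valency-on-path {p} {x} path x∈p = begin
    deg G x + leaf + pend                         ≡⟨ cong (λ t → t + leaf + pend) (deg≡inPath+outPath G p x) ⟩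
    inPath G p x + outPath G p x + leaf + pend    ≡⟨ cong (_+ pend) (xy∙z≈xz∙y (inPath G p x) (outPath G p x) leaf) ⟩
    inPath G p x + leaf + outPath G p x + pend    ≤⟨ +-monoˡ-≤ pend (+-monoˡ-≤ (outPath G p x) (inPath+leaf≤2 G acyclic path x∈p)) ⟩
    2 + outPath G p x + pend                      ≡⟨ +-assoc 2 (outPath G p x) pend ⟩
    2 + (outPath G p x + pend)                    ∎
    where
    open ≤-Reasoning
    leaf = indicator (isLeaf G x)
    pend = pendants f x

  spread-on-path : ∀ {p x} → IsPath G p → x ∈ p → SpreadAtMost x (weight p x)
  spread-on-path {p} {x} path x∈p {y₁} e₁ e₂ = ≤-pred (begin
    suc (c (vertex x) _)                                 ≤⟨ colour-spread x e₁ e₂ ⟩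
    c (vertex x) y₁ + valency x                          ≤⟨ +-monoʳ-≤ (c (vertex x) y₁) (valency-on-path path x∈p) ⟩
    c (vertex x) y₁ + suc (weight p x)                   ≡⟨ +-suc (c (vertex x) y₁) (weight p x) ⟩
    suc (c (vertex x) y₁ + weight p x)                   ∎)
    where open ≤-Reasoning

  path-weight≤ : ∀ {a q} → IsPath G (a ∷ q) → sum (map (weight (a ∷ q)) (a ∷ q)) ≤ suc (LP G (a ∷ q) + d)
  path-weight≤ {a} {q} (_ , unique) = begin
    sum (map (weight p) p)
      ≡⟨ sum-map-+ (λ _ → 1) (λ x → outPath G p x + pendants f x) p ⟩
    sum (map (λ _ → 1) p) + sum (map (λ x → outPath G p x + pendants f x) p)
      ≡⟨ cong₂ _+_ (sum-map-one p) (sum-map-+ (outPath G p) (pendants f) p) ⟩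
    length p + (sum (map (outPath G p) p) + sum (map (pendants f) p))
      ≤⟨ +-monoʳ-≤ (length p) (+-mono-≤ outPath≤boundary pendants≤d) ⟩
    suc (length q) + (boundary + d)
      ≡⟨ cong suc (sym (+-assoc (length q) boundary d)) ⟩
    suc (LP G p + d) ∎
    where
    open ≤-Reasoning
    p = a ∷ q
    boundary = sumFin (λ v → count (λ w → (v ∈ᵇ p) ∧ not (w ∈ᵇ p) ∧ adj G v w))
    outPath≤boundary : sum (map (outPath G p) p) ≤ boundary
    outPath≤boundary = ≤-trans (sum-map≤sumFin (outPath G p) unique) (sumFin-mono on-path)
      where
      on-path : ∀ v → (if v ∈ᵇ p then outPath G p v else 0) ≤ count (λ w → (v ∈ᵇ p) ∧ not (w ∈ᵇ p) ∧ adj G v w)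
      on-path v with v ∈ᵇ p
      ... | true  = ≤-refl
      ... | false = z≤n
    pendants≤d : sum (map (pendants f) p) ≤ d
    pendants≤d = ≤-trans (sum-map≤sumFin (pendants f) unique) (≤-trans (sumFin-mono on-path) (sumFin-pendants≤ f))
      where
      on-path : ∀ v → (if v ∈ᵇ p then pendants f v else 0) ≤ pendants f v
      on-path v with v ∈ᵇ p
      ... | true  = ≤-refl
      ... | false = z≤n

  leaf-colour-drift : ∀ {a q b} → IsPath G (a ∷ q) → last (a ∷ q) ≡ just b →
    T (isLeaf G a) → T (isLeaf G b) → apexColour b ≤ apexColour a + suc (LP G (a ∷ q) + d)
  leaf-colour-drift {a} {q} {b} path last≡b leaf-a leaf-b = begin
    c apex (vertex b)                            ≡⟨ symm apex (vertex b) leaf-b ⟩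
    c (vertex b) apex                            ≤⟨ colour-drift (weight p) (proj₁ path) (tabulate (spread-on-path path)) last≡b leaf-a leaf-b ⟩
    c (vertex a) apex + sum (map (weight p) p)   ≤⟨ +-monoʳ-≤ (c (vertex a) apex) (path-weight≤ path) ⟩
    c (vertex a) apex + suc (LP G p + d)         ≡⟨ cong (_+ suc (LP G p + d)) (symm (vertex a) apex leaf-a) ⟩
    c apex (vertex a) + suc (LP G p + d)         ∎
    where
    open ≤-Reasoning
    p = a ∷ q

  leaf-colour< : Connected G → ∀ m → LPBoundedBy G m → ∀ {a i} → T (isLeaf G a) → T (isLeaf G i) →
    apexColour i < apexColour a + (2 + (m + d))
  leaf-colour< connected m LP≤m {a} {i} leaf-a leaf-i with a ≟ i
  ... | yes refl = m<m+n (apexColour a) z<s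
  ... | no  a≢i with connected a i
  ...   | _ ∷ q , linked , unique , refl , last≡i = begin-strict
    apexColour i                       ≤⟨ leaf-colour-drift (linked , unique) last≡i leaf-a leaf-i ⟩
    apexColour a + suc (LP G p + d)    ≤⟨ +-monoʳ-≤ (apexColour a) (s≤s (+-monoˡ-≤ d LP≤)) ⟩
    apexColour a + suc (m + d)         <⟨ +-monoʳ-< (apexColour a) (n<1+n (suc (m + d))) ⟩
    apexColour a + (2 + (m + d))       ∎
    where
    open ≤-Reasoning
    p = a ∷ q
    LP≤ : LP G p ≤ m
    LP≤ = LP≤m a i p a≢i (linked , unique , refl , last≡i)

  numLeaves≤ : Connected G → ∀ m → LPBoundedBy G m → numLeaves G ≤ 2 + (m + d)
  numLeaves≤ connected m LP≤m with any? (λ i → T? (isLeaf G i))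
  ... | no  no-leaf =
    subst (_≤ 2 + (m + d)) (sym (count-zero (isLeaf G) (λ i leaf-i → no-leaf (i , leaf-i)))) z≤n
  ... | yes (_ , leaf-j) with minimum-on (isLeaf G) apexColour leaf-j
  ...   | a , leaf-a , least =
    injective-count≤length (apexColour a) (2 + (m + d)) (isLeaf G) apexColour
      (λ i leaf-i → least i leaf-i , leaf-colour< connected m LP≤m leaf-a leaf-i)
      injective
    where
    injective : ∀ i i′ → T (isLeaf G i) → T (isLeaf G i′) → apexColour i ≡ apexColour i′ → i ≡ i′
    injective i i′ leaf-i leaf-i′ same with proper apex (vertex i) (vertex i′) leaf-i leaf-i′ same
    ... | refl = refl

corollary3 : ∀ (n : ℕ) (T : Graph n) → 2 ≤ n → IsTree T →
    ∀ (m : ℕ) → IsM T m → ∀ (d : ℕ) → IsDeficiency (tildeAdj T) d →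
    numLeaves T ∸ m ∸ 2 ≤ d
corollary3 n G _ (connected , acyclic) m (_ , LP≤m) d ((f , C) , _) = begin
  numLeaves G ∸ m ∸ 2 ≤⟨ ∸-monoˡ-≤ 2 (m≤n+o⇒m∸n≤o (numLeaves G) m leaves≤) ⟩
  2 + d ∸ 2           ≡⟨ m+n∸m≡n 2 d ⟩
  d                   ∎
  where
  open ≤-Reasoning
  leaves≤ : numLeaves G ≤ m + (2 + d)
  leaves≤ = ≤-trans (LeafColours.numLeaves≤ G acyclic f C connected m LP≤m) (≤-reflexive (x∙yz≈y∙xz 2 m d))
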